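{- Let $A,B\in\mathbb{R}^{n\times n}$ form a diagonally $h$-dominant pair. Let $G$ be a word over the alphabet $\{A,B\}$ that contains every word of length $n$ over $\{A,B\}$ as a (contiguous) subword, let $g$ be the length of $G$, and assume $h=2ng+1$. Choose $X^{(ng+1)}\in\{A,B\}$ arbitrarily and let $X^{(t)}$ denote the $t$-th letter of the word $G^nX^{(ng+1)}G^n$ (which has length $h$), for $t=1,\ldots,h$. Then for any fixed $\kappa_0,\kappa_h\in\{1,\ldots,n\}$, the expression $$\beta=X^{(1)}_{\kappa_0\kappa_1}+X^{(2)}_{\kappa_1\kappa_2}+\cdots+X^{(h)}_{\kappa_{h-1}\kappa_h},$$ considered over all tuples $(\kappa_1,\ldots,\kappa_{h-1})\in\{1,\ldots,n\}^{h-1}$, attains its minimum on some tuple satisfying $\kappa_{ng}=\kappa_{ng+1}$.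
   Context: For $H>0$, a matrix $M\in\mathbb{R}^{n\times n}$ is diagonally $H$-dominant if $M_{ij}\geq\max\{M_{ii},M_{jj}\}+H|M_{ii}-M_{jj}|$ for all $i,j$. Matrices $A,B\in\mathbb{R}^{n\times n}$ form a diagonally $H$-dominant pair if $A_{ii}=B_{ii}$ for all $i$ and the matrix $A\oplus B$ with entries $\min\{A_{ij},B_{ij}\}$ is diagonally $H$-dominant. -}

module Defs where

open import Data.Nat using (ℕ; zero; suc)
open import Data.Fin using (Fin; zero; suc)
open import Data.List using (List; []; _∷_; _++_; concat; replicate; length)
open import Data.Vec using (Vec; toList)
open import Data.Product using (Σ; ∃; _×_; _,_)
open import Data.Sum using (_⊎_; inj₁; inj₂)
open import Relation.Binary.PropositionalEquality using (_≡_)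
open import Algebra.Structures using (IsAbelianGroup)
open import Relation.Binary.Structures using (IsTotalOrder)

-- A totally ordered abelian group (equality is propositional equality).
-- ℝ with +, 0, -, ≤ is an instance; the theorem only uses this structure
-- of ℝ (addition, order, |.|, and multiplication by the natural number H).
record OrderedAbelianGroup : Set₁ where
  infixl 6 _+_
  infix 4 _≤_
  field
    Carrier        : Set
    _+_            : Carrier → Carrier → Carrier
    0#             : Carrier
    -_             : Carrier → Carrier
    _≤_            : Carrier → Carrier → Set
    isAbelianGroup : IsAbelianGroup _≡_ _+_ 0# -_
    isTotalOrder   : IsTotalOrder _≡_ _≤_
    +-monoˡ-≤      : ∀ {x y} z → x ≤ y → x + z ≤ y + z

  _-_ : Carrier → Carrier → Carrier
  x - y = x + (- y)

  total : ∀ x y → (x ≤ y) ⊎ (y ≤ x)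
  total = IsTotalOrder.total isTotalOrder

  max : Carrier → Carrier → Carrier
  max x y with total x y
  ... | inj₁ _ = y
  ... | inj₂ _ = x

  ∣_∣ : Carrier → Carrier
  ∣ x ∣ = max x (- x)

  _·_ : ℕ → Carrier → Carrier
  zero  · x = 0#
  suc k · x = x + (k · x)

module _ (R : OrderedAbelianGroup) where
  open OrderedAbelianGroup R

  Matrix : ℕ → Set
  Matrix n = Fin n → Fin n → Carrier

  DiagDominant : ∀ {n} → ℕ → Matrix n → Set
  DiagDominant H M = ∀ i j → max (M i i) (M j j) + (H · ∣ M i i - M j j ∣) ≤ M i j

  _⊕_ : ∀ {n} → Matrix n → Matrix n → Matrix n
  (A ⊕ B) i j with total (A i j) (B i j)
  ... | inj₁ _ = A i j
  ... | inj₂ _ = B i j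

  DominantPair : ∀ {n} → ℕ → Matrix n → Matrix n → Set
  DominantPair H A B = (∀ i → A i i ≡ B i i) × DiagDominant H (A ⊕ B)

data Letter : Set where
  𝐀 𝐁 : Letter

Subword : List Letter → List Letter → Set
Subword u w = Σ (List Letter) λ p → Σ (List Letter) λ s → w ≡ p ++ (u ++ s)

sandwich : ℕ → List Letter → Letter → List Letter
sandwich n G x = concat (replicate n G) ++ (x ∷ concat (replicate n G))

module _ (R : OrderedAbelianGroup) where
  open OrderedAbelianGroup R

  letterMat : ∀ {n} → Matrix R n → Matrix R n → Letter → Matrix R n
  letterMat A B 𝐀 = A
  letterMat A B 𝐁 = B

  β : ∀ {n} → Matrix R n → Matrix R n → (w : List Letter) →
      (Fin (suc (length w)) → Fin n) → Carrier
  β A B []      κ = 0#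
  β A B (a ∷ w) κ = letterMat A B a (κ zero) (κ (suc zero)) + β A B w (λ i → κ (suc i))

module Submission where

-- A choice of indices κ₀ … κₕ for a word X⁽¹⁾ … X⁽ʰ⁾ is a walk on the
-- vertices {1..n} reading the t-th letter while stepping from κ_{t-1} to κ_t;
-- β is the sum of the step costs.  A step u → u (a "stay") costs the common
-- diagonal entry d(u) = A_uu = B_uu; a step u → t with t ≠ u is a "move".
--
-- Idea: every walk over G^n X G^n is weakly beaten by one that stays while
-- reading the middle letter X; applied to a cheapest walk (which exists, as
-- there are finitely many walks) this is the theorem.  Cutting loops until the
--    moves start at distinct vertices leaves fewer than n moves.
--  * Rerouting: a walk over G^k with < k moves stays put during a whole copy
--    of G (pigeonhole).  Valley lemma: a segment S between two such
--    stationary G-blocks can be replaced by a route inside G down to the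
--    vertex m of S with least d, a stay at m during all of S, and a route
--    inside G back up; routes fit into G since they have ≤ n moves and G
--    contains every word of length n.
--  * MiddleStayTheorem: with < n moves both halves G^n have a stationary
--    block, and the valley lemma between them puts a stay in the middle.

open import Defs
open import Data.Nat as ℕ using (ℕ; zero; suc; z≤n; s≤s)
open import Data.Nat.Properties as ℕₚ using ()
open import Data.Fin using (Fin; zero; suc; fromℕ; toℕ; _≟_)
open import Data.Fin.Properties using (injective⇒≤)
open import Data.List using (List; []; _∷_; _++_; length; concat; replicate; map; concatMap; allFin)
open import Data.List.Properties using (length-++; ++-assoc)
open import Data.List.Membership.Propositional using (_∈_; lose)
open import Data.List.Membership.Propositional.Properties using (∈-map⁺; ∈-concatMap⁺; ∈-allFin)
open import Data.List.Relation.Unary.Any using (here)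
import Data.List.Relation.Unary.All as ListAll
import Data.List.Extrema
open import Data.Vec using (Vec; toList; []; _∷_)
import Data.Vec as Vec
open import Data.Vec.Relation.Unary.All using (All; []; _∷_)
open import Data.Vec.Relation.Unary.AllPairs using ([]; _∷_)
open import Data.Vec.Relation.Unary.Unique.Propositional using (Unique)
open import Data.Vec.Relation.Unary.Unique.Propositional.Properties using (lookup-injective)
open import Data.Product using (Σ; _×_; _,_; proj₁; proj₂)
open import Data.Sum using (_⊎_; inj₁; inj₂)
open import Data.Empty using (⊥-elim)
open import Relation.Nullary using (¬_; Dec; yes; no)
open import Function using (_∘_)
open import Relation.Binary.PropositionalEquality
  using (_≡_; _≢_; refl; sym; trans; cong; cong₂; subst)
open import Relation.Binary.Bundles using (TotalOrder)
open import Algebra.Bundles using (CommutativeMonoid)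
open import Algebra.Structures using (IsAbelianGroup)
open import Relation.Binary.Structures using (IsTotalOrder)
open import Level using (0ℓ)
import Algebra.Solver.CommutativeMonoid as CommutativeMonoidSolver
import Relation.Binary.Reasoning.PartialOrder as PartialOrderReasoning
open import Data.Nat.Tactic.RingSolver using (solve-∀)
import Algebra.Properties.CommutativeSemigroup as CommutativeSemigroupProperties

length-copies : ∀ (G : List Letter) k → length (concat (replicate k G)) ≡ k ℕ.* length G
length-copies G zero    = refl
length-copies G (suc k) = trans (length-++ G) (cong (length G ℕ.+_) (length-copies G k))

module OrderedGroupFacts (R : OrderedAbelianGroup) where
  open OrderedAbelianGroup R public
  private
    module AG = IsAbelianGroup isAbelianGroup
    module TO = IsTotalOrder isTotalOrder

  totalOrder : TotalOrder 0ℓ 0ℓ 0ℓ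
  totalOrder = record { Carrier = Carrier ; _≈_ = _≡_ ; _≤_ = _≤_ ; isTotalOrder = isTotalOrder }

  commutativeMonoid : CommutativeMonoid 0ℓ 0ℓ
  commutativeMonoid = record
    { Carrier = Carrier ; _≈_ = _≡_ ; _∙_ = _+_ ; ε = 0#
    ; isCommutativeMonoid = AG.isCommutativeMonoid }

  module ≤-Reasoning = PartialOrderReasoning (TotalOrder.poset totalOrder)

  open CommutativeSemigroupProperties (CommutativeMonoid.commutativeSemigroup commutativeMonoid) public
    using (interchange; x∙yz≈y∙xz)

  ≤-refl : ∀ {x} → x ≤ x
  ≤-refl = TO.refl

  ≤-trans : ∀ {x y z} → x ≤ y → y ≤ z → x ≤ z
  ≤-trans = TO.trans

  ≤-reflexive : ∀ {x y} → x ≡ y → x ≤ y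
  ≤-reflexive refl = TO.refl

  +-assoc : ∀ x y z → (x + y) + z ≡ x + (y + z)
  +-assoc = AG.assoc

  +-identityˡ : ∀ x → 0# + x ≡ x
  +-identityˡ = AG.identityˡ

  +-identityʳ : ∀ x → x + 0# ≡ x
  +-identityʳ = AG.identityʳ

  +-monoʳ-≤ : ∀ {x y} z → x ≤ y → z + x ≤ z + y
  +-monoʳ-≤ {x} {y} z x≤y =
    subst (_≤ z + y) (AG.comm x z) (subst (x + z ≤_) (AG.comm y z) (+-monoˡ-≤ z x≤y))

  +-mono-≤ : ∀ {a b c d} → a ≤ b → c ≤ d → a + c ≤ b + d
  +-mono-≤ {b = b} {c} a≤b c≤d = ≤-trans (+-monoˡ-≤ c a≤b) (+-monoʳ-≤ b c≤d)

  x≤x+y : ∀ {x y} → 0# ≤ y → x ≤ x + y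
  x≤x+y {x} 0≤y = ≤-trans (≤-reflexive (sym (+-identityʳ x))) (+-monoʳ-≤ x 0≤y)

  x-y+y≡x : ∀ x y → (x - y) + y ≡ x
  x-y+y≡x x y = trans (+-assoc x (- y) y) (trans (cong (x +_) (AG.inverseˡ y)) (+-identityʳ x))

  0≤x-y : ∀ {x y} → y ≤ x → 0# ≤ x - y
  0≤x-y {x} {y} y≤x = ≤-trans (≤-reflexive (sym (AG.inverseʳ y))) (+-monoˡ-≤ (- y) y≤x)

  ·-monoʳ-≤ : ∀ k {x y} → x ≤ y → k · x ≤ k · y
  ·-monoʳ-≤ zero    x≤y = ≤-refl
  ·-monoʳ-≤ (suc k) x≤y = +-mono-≤ x≤y (·-monoʳ-≤ k x≤y)

  0≤k·x : ∀ k {x} → 0# ≤ x → 0# ≤ k · x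
  0≤k·x zero    0≤x = ≤-refl
  0≤k·x (suc k) 0≤x = ≤-trans (≤-reflexive (sym (+-identityʳ 0#))) (+-mono-≤ 0≤x (0≤k·x k 0≤x))

  ·-monoˡ-≤ : ∀ {x} → 0# ≤ x → ∀ {k l} → k ℕ.≤ l → k · x ≤ l · x
  ·-monoˡ-≤ 0≤x {l = l} z≤n     = 0≤k·x l 0≤x
  ·-monoˡ-≤ {x} 0≤x (s≤s k≤l) = +-monoʳ-≤ x (·-monoˡ-≤ 0≤x k≤l)

  ·-distribʳ-+ : ∀ k l x → (k ℕ.+ l) · x ≡ k · x + l · x
  ·-distribʳ-+ zero    l x = sym (+-identityˡ (l · x))
  ·-distribʳ-+ (suc k) l x = trans (cong (x +_) (·-distribʳ-+ k l x)) (sym (+-assoc x (k · x) (l · x)))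

  ·-sub-cancel : ∀ k x y → k · (x - y) + k · y ≡ k · x
  ·-sub-cancel zero    x y = +-identityʳ 0#
  ·-sub-cancel (suc k) x y = begin
      ((x - y) + k · (x - y)) + (y + k · y)
        ≡⟨ interchange (x - y) (k · (x - y)) y (k · y) ⟩
      ((x - y) + y) + (k · (x - y) + k · y)
        ≡⟨ cong₂ _+_ (x-y+y≡x x y) (·-sub-cancel k x y) ⟩
      x + k · x ∎
    where
    open Relation.Binary.PropositionalEquality.≡-Reasoning

  length-·-distrib : ∀ {A : Set} (w₁ w₂ : List A) x → length (w₁ ++ w₂) · x ≡ length w₁ · x + length w₂ · x
  length-·-distrib w₁ w₂ x = trans (cong (_· x) (length-++ w₁)) (·-distribʳ-+ (length w₁) (length w₂) x)

  module +-Solver = CommutativeMonoidSolver commutativeMonoid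

  x≤max : ∀ x y → x ≤ max x y
  x≤max x y with total x y
  ... | inj₁ x≤y = x≤y
  ... | inj₂ _   = ≤-refl

  y≤max : ∀ x y → y ≤ max x y
  y≤max x y with total x y
  ... | inj₁ _   = ≤-refl
  ... | inj₂ y≤x = y≤x

  x≤∣x∣ : ∀ x → x ≤ ∣ x ∣
  x≤∣x∣ x = x≤max x (- x)

  0≤∣x∣ : ∀ x → 0# ≤ ∣ x ∣
  0≤∣x∣ x with total 0# x
  ... | inj₁ 0≤x = ≤-trans 0≤x (x≤∣x∣ x)
  ... | inj₂ x≤0 = ≤-trans 0≤-x (y≤max x (- x))
    where
    0≤-x : 0# ≤ - x
    0≤-x = ≤-trans (≤-reflexive (sym (AG.inverseʳ x)))
                   (≤-trans (+-monoˡ-≤ (- x) x≤0) (≤-reflexive (+-identityˡ (- x))))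

module Walks (R : OrderedAbelianGroup) {n : ℕ} (A B : Matrix R n)
             (sameDiagonal : ∀ i → A i i ≡ B i i) where
  open OrderedGroupFacts R

  Vertex : Set
  Vertex = Fin n

  M : Letter → Vertex → Vertex → Carrier
  M = letterMat R A B

  d : Vertex → Carrier
  d i = A i i

  M-diag : ∀ ℓ i → M ℓ i i ≡ d i
  M-diag 𝐀 i = refl
  M-diag 𝐁 i = sym (sameDiagonal i)

  private variable
    w w₁ w₂ : List Letter
    u v c t : Vertex

  data Walk : List Letter → Vertex → Vertex → Set where
    nil  : ∀ {v} → Walk [] v v
    step : ∀ {ℓ w u v} t → Walk w t v → Walk (ℓ ∷ w) u v

  cost : Walk w u v → Carrier
  cost nil                       = 0#
  cost (step {ℓ = ℓ} {u = u} t p) = M ℓ u t + cost p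

  isMove : Dec (u ≡ t) → ℕ
  isMove (yes _) = 0
  isMove (no _)  = 1

  moves : Walk w u v → ℕ
  moves nil                = 0
  moves (step {u = u} t p) = isMove (u ≟ t) ℕ.+ moves p

  moves-step-≡ : ∀ {ℓ} (p : Walk w u v) → moves (step {ℓ = ℓ} {u = u} u p) ≡ moves p
  moves-step-≡ {u = u} p with u ≟ u
  ... | yes _   = refl
  ... | no u≢u  = ⊥-elim (u≢u refl)

  moves-step-≢ : ∀ {ℓ} (p : Walk w t v) → u ≢ t → moves (step {ℓ = ℓ} {u = u} t p) ≡ suc (moves p)
  moves-step-≢ {t = t} {u = u} p u≢t with u ≟ t
  ... | yes u≡t = ⊥-elim (u≢t u≡t)
  ... | no _    = refl

  infixr 5 _++ᵂ_
  _++ᵂ_ : Walk w₁ u c → Walk w₂ c v → Walk (w₁ ++ w₂) u v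
  nil      ++ᵂ q = q
  step t p ++ᵂ q = step t (p ++ᵂ q)

  cost-++ : (p : Walk w₁ u c) (q : Walk w₂ c v) → cost (p ++ᵂ q) ≡ cost p + cost q
  cost-++ nil q = sym (+-identityˡ (cost q))
  cost-++ (step {ℓ = ℓ} {u = u} t p) q =
    trans (cong (M ℓ u t +_) (cost-++ p q)) (sym (+-assoc (M ℓ u t) (cost p) (cost q)))

  moves-++ : (p : Walk w₁ u c) (q : Walk w₂ c v) → moves (p ++ᵂ q) ≡ moves p ℕ.+ moves q
  moves-++ nil q = refl
  moves-++ (step {u = u} t p) q =
    trans (cong (isMove (u ≟ t) ℕ.+_) (moves-++ p q)) (sym (ℕₚ.+-assoc (isMove (u ≟ t)) (moves p) (moves q)))

  join : w₁ ++ w₂ ≡ w → Walk w₁ u c → Walk w₂ c v → Walk w u v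
  join refl p q = p ++ᵂ q

  cost-join : (e : w₁ ++ w₂ ≡ w) (p : Walk w₁ u c) (q : Walk w₂ c v) → cost (join e p q) ≡ cost p + cost q
  cost-join refl = cost-++

  moves-join : (e : w₁ ++ w₂ ≡ w) (p : Walk w₁ u c) (q : Walk w₂ c v) → moves (join e p q) ≡ moves p ℕ.+ moves q
  moves-join refl = moves-++

  stays : ∀ w v → Walk w v v
  stays []      v = nil
  stays (ℓ ∷ w) v = step v (stays w v)

  cost-stays : ∀ w v → cost (stays w v) ≡ length w · d v
  cost-stays []      v = refl
  cost-stays (ℓ ∷ w) v = cong₂ _+_ (M-diag ℓ v) (cost-stays w v)

  cost-stays-++ : ∀ w₁ w₂ v → cost (stays (w₁ ++ w₂) v) ≡ cost (stays w₁ v) + cost (stays w₂ v)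
  cost-stays-++ []       w₂ v = sym (+-identityˡ _)
  cost-stays-++ (ℓ ∷ w₁) w₂ v =
    trans (cong (M ℓ v v +_) (cost-stays-++ w₁ w₂ v)) (sym (+-assoc (M ℓ v v) _ _))

  moves-stays : ∀ w v → moves (stays w v) ≡ 0
  moves-stays []      v = refl
  moves-stays (ℓ ∷ w) v = trans (moves-step-≡ {ℓ = ℓ} (stays w v)) (moves-stays w v)

  stationary : (p : Walk w u v) → moves p ≡ 0 → (u ≡ v) × (cost p ≡ length w · d u)
  stationary nil _ = refl , refl
  stationary (step {u = u} t p) none with u ≟ t
  stationary (step {ℓ = ℓ} {u = u} .u p) none | yes refl with stationary p none
  ... | refl , cost-p = refl , cong₂ _+_ (M-diag ℓ u) cost-p
  stationary (step t p) () | no _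

  AllV : (Vertex → Set) → Walk w u v → Set
  AllV Q (nil {v = v})       = Q v
  AllV Q (step {u = u} t p) = Q u × AllV Q p

  AllV-head : ∀ {Q} (p : Walk w u v) → AllV Q p → Q u
  AllV-head nil        q       = q
  AllV-head (step t p) (q , _) = q

  AllV-last : ∀ {Q} (p : Walk w u v) → AllV Q p → Q v
  AllV-last nil        q       = q
  AllV-last (step t p) (_ , q) = AllV-last p q

  AllV-mono : ∀ {Q Q′ : Vertex → Set} → (∀ {y} → Q y → Q′ y) → (p : Walk w u v) → AllV Q p → AllV Q′ p
  AllV-mono f nil        q        = f q
  AllV-mono f (step t p) (q , qs) = f q , AllV-mono f p qs

  data _∈ᵂ_ (y : Vertex) : Walk w u v → Set where
    here  : {p : Walk w y v} → y ∈ᵂ p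
    there : ∀ {ℓ} {p : Walk w t v} → y ∈ᵂ p → y ∈ᵂ step {ℓ = ℓ} {u = u} t p

  _∈ᵂ?_ : ∀ y (p : Walk w u v) → Dec (y ∈ᵂ p)
  _∈ᵂ?_ {u = u} y p with y ≟ u
  ... | yes refl = yes here
  y ∈ᵂ? nil      | no y≢u = no λ { here → y≢u refl }
  y ∈ᵂ? step t p | no y≢u with y ∈ᵂ? p
  ... | yes y∈p = yes (there y∈p)
  ... | no y∉p  = no λ { here → y≢u refl ; (there y∈p) → y∉p y∈p }

  lowestVertex : (p : Walk w u v) → Σ Vertex λ m → m ∈ᵂ p × AllV (λ y → d m ≤ d y) p
  lowestVertex nil = _ , here , ≤-refl
  lowestVertex (step {u = u} t p) with lowestVertex p
  ... | m , m∈p , low with total (d u) (d m)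
  ...   | inj₁ du≤dm = u , here , ≤-refl , AllV-mono (≤-trans du≤dm) p low
  ...   | inj₂ dm≤du = m , there m∈p , dm≤du , low

  splitWord : ∀ w₁ (p : Walk (w₁ ++ w₂) u v) →
    Σ Vertex λ c → Σ (Walk w₁ u c) λ p₁ → Σ (Walk w₂ c v) λ p₂ → p₁ ++ᵂ p₂ ≡ p
  splitWord []       p          = _ , nil , p , refl
  splitWord (ℓ ∷ w₁) (step t p) with splitWord w₁ p
  ... | c , p₁ , p₂ , refl = c , step t p₁ , p₂ , refl

  record Split (p : Walk w u v) (c : Vertex) : Set₁ where
    field
      leftWord rightWord : List Letter
      words       : leftWord ++ rightWord ≡ w
      left        : Walk leftWord u c
      right       : Walk rightWord c v
      cost-split  : cost p ≡ cost left + cost right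
      moves-split : moves p ≡ moves left ℕ.+ moves right
      all-split   : ∀ {Q} → AllV Q p → AllV Q left × AllV Q right

  splitAt : (p : Walk w u v) → c ∈ᵂ p → Split p c
  splitAt p here = record
    { leftWord = [] ; rightWord = _ ; words = refl ; left = nil ; right = p
    ; cost-split = sym (+-identityˡ (cost p)) ; moves-split = refl
    ; all-split = λ q → AllV-head p q , q }
  splitAt (step {ℓ = ℓ} {u = u} t p) (there c∈p) = record
    { leftWord = ℓ ∷ leftWord ; rightWord = rightWord ; words = cong (ℓ ∷_) words ; left = step t left ; right = right
    ; cost-split  = trans (cong (M ℓ u t +_) cost-split) (sym (+-assoc (M ℓ u t) _ _))
    ; moves-split = trans (cong (isMove (u ≟ t) ℕ.+_) moves-split) (sym (ℕₚ.+-assoc (isMove (u ≟ t)) _ _))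
    ; all-split   = λ { (q , qs) → (q , proj₁ (all-split qs)) , proj₂ (all-split qs) } }
    where open Split (splitAt p c∈p)

  -- Compression: the moving steps of S read as a walk of their own.  The
  -- dropped stays each cost at least μ when all vertices of S have d ≥ μ.
  record Compression (μ : Carrier) (S : Walk w u v) : Set where
    field
      route        : List Letter
      path         : Walk route u v
      route-length : length route ≡ moves S
      dropped      : ℕ
      length-split : dropped ℕ.+ length route ≡ length w
      cost-bound   : cost path + dropped · μ ≤ cost S

  compress : ∀ {μ} (S : Walk w u v) → AllV (λ y → μ ≤ d y) S → Compression μ S
  compress nil _ = record
    { route = [] ; path = nil ; route-length = refl ; dropped = 0 ; length-split = refl
    ; cost-bound = ≤-reflexive (+-identityˡ 0#) }
  compress {μ = μ} (step {ℓ = ℓ} {u = u} t S) (μ≤du , low) with u ≟ t | compress S low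
  ... | yes refl | C = record
    { route = route ; path = path ; route-length = trans route-length (sym (moves-step-≡ {ℓ = ℓ} S))
    ; dropped = suc dropped ; length-split = cong suc length-split
    ; cost-bound = begin
        cost path + (μ + dropped · μ)  ≡⟨ x∙yz≈y∙xz (cost path) μ (dropped · μ) ⟩
        μ + (cost path + dropped · μ)  ≤⟨ +-mono-≤ μ≤M cost-bound ⟩
        M ℓ u u + cost S               ∎ }
    where
    open Compression C
    open ≤-Reasoning
    μ≤M : μ ≤ M ℓ u u
    μ≤M = ≤-trans μ≤du (≤-reflexive (sym (M-diag ℓ u)))
  ... | no u≢t | C = record
    { route = ℓ ∷ route ; path = step t path
    ; route-length = trans (cong suc route-length) (sym (moves-step-≢ {ℓ = ℓ} S u≢t))
    ; dropped = dropped ; length-split = trans (ℕₚ.+-suc dropped _) (cong suc length-split)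
    ; cost-bound = ≤-trans (≤-reflexive (+-assoc (M ℓ u t) (cost path) (dropped · μ)))
                           (+-monoʳ-≤ (M ℓ u t) cost-bound) }
    where open Compression C

  allWalks : ∀ w u v → List (Walk w u v)
  allWalks []      u v with u ≟ v
  ... | yes refl = nil ∷ []
  ... | no _     = []
  allWalks (ℓ ∷ w) u v = concatMap (λ t → map (step t) (allWalks w t v)) (allFin n)

  allWalks-complete : (p : Walk w u v) → p ∈ allWalks w u v
  allWalks-complete (nil {v = v}) with v ≟ v
  ... | yes refl = here refl
  ... | no v≢v   = ⊥-elim (v≢v refl)
  allWalks-complete {w = ℓ ∷ w} {v = v} (step t p) =
    ∈-concatMap⁺ (λ t′ → map (step t′) (allWalks w t′ v))
                 (lose (∈-allFin t) (∈-map⁺ (step t) (allWalks-complete p)))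

  cheapestWalk : Walk w u v → Σ (Walk w u v) λ p → ∀ q → cost p ≤ cost q
  cheapestWalk {w = w} {u = u} {v = v} p₀ =
    argmin cost p₀ (allWalks w u v) ,
    λ q → ListAll.lookup (f[argmin]≤f[xs] p₀ (allWalks w u v)) (allWalks-complete q)
    where open Data.List.Extrema totalOrder using (argmin; f[argmin]≤f[xs])

  positions : Walk w u v → Fin (suc (length w)) → Vertex
  positions {u = u} p          zero    = u
  positions         (step t p) (suc i) = positions p i

  β-positions : (p : Walk w u v) → β R A B w (positions p) ≡ cost p
  β-positions nil = refl
  β-positions (step {ℓ = ℓ} {u = u} t p) = cong (M ℓ u t +_) (β-positions p)

  positions-last : (p : Walk w u v) → positions p (fromℕ (length w)) ≡ v
  positions-last nil        = refl
  positions-last (step t p) = positions-last p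

  positions-stay : ∀ {ℓ} (p : Walk w₁ u c) (q : Walk w₂ c v) (i : Fin (suc (length (w₁ ++ ℓ ∷ w₂)))) →
    toℕ i ≡ length w₁ ⊎ toℕ i ≡ suc (length w₁) → positions (p ++ᵂ step {ℓ = ℓ} c q) i ≡ c
  positions-stay nil        q zero             _ = refl
  positions-stay nil        q (suc zero)       _ = refl
  positions-stay nil        q (suc (suc i))    (inj₁ ())
  positions-stay nil        q (suc (suc i))    (inj₂ ())
  positions-stay (step t p) q zero             (inj₁ ())
  positions-stay (step t p) q zero             (inj₂ ())
  positions-stay (step t p) q (suc i)          (inj₁ e) = positions-stay p q i (inj₁ (ℕₚ.suc-injective e))
  positions-stay (step t p) q (suc i)          (inj₂ e) = positions-stay p q i (inj₂ (ℕₚ.suc-injective e))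

  walkOf : ∀ w (κ : Fin (suc (length w)) → Vertex) → Walk w (κ zero) (κ (fromℕ (length w)))
  walkOf []      κ = nil
  walkOf (ℓ ∷ w) κ = step (κ (suc zero)) (walkOf w (λ i → κ (suc i)))

  cost-walkOf : ∀ w κ → cost (walkOf w κ) ≡ β R A B w κ
  cost-walkOf []      κ = refl
  cost-walkOf (ℓ ∷ w) κ = cong (M ℓ (κ zero) (κ (suc zero)) +_) (cost-walkOf w (λ i → κ (suc i)))

-- Consequences of the diagonal H-dominance of A ⊕ B: loops in short walks
-- do not pay off.
module Dominance (R : OrderedAbelianGroup) {n : ℕ} (A B : Matrix R n)
                 (sameDiagonal : ∀ i → A i i ≡ B i i) (H : ℕ)
                 (dominant : DiagDominant R H (_⊕_ R A B)) where
  open OrderedGroupFacts R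
  open Walks R A B sameDiagonal

  private variable
    w : List Letter
    u v : Vertex

  ⊕-diag : ∀ i → _⊕_ R A B i i ≡ d i
  ⊕-diag i with total (A i i) (B i i)
  ... | inj₁ _ = refl
  ... | inj₂ _ = sym (sameDiagonal i)

  ⊕≤M : ∀ ℓ i j → _⊕_ R A B i j ≤ M ℓ i j
  ⊕≤M 𝐀 i j with total (A i j) (B i j)
  ... | inj₁ _   = ≤-refl
  ... | inj₂ B≤A = B≤A
  ⊕≤M 𝐁 i j with total (A i j) (B i j)
  ... | inj₁ A≤B = A≤B
  ... | inj₂ _   = ≤-refl

  step-lower : ∀ ℓ u t → max (d u) (d t) + H · ∣ d u - d t ∣ ≤ M ℓ u t
  step-lower ℓ u t =
    ≤-trans (≤-reflexive (cong₂ bound (sym (⊕-diag u)) (sym (⊕-diag t))))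
            (≤-trans (dominant u t) (⊕≤M ℓ u t))
    where
    bound : Carrier → Carrier → Carrier
    bound a b = max a b + H · ∣ a - b ∣

  start≤step : ∀ ℓ u t → d u ≤ M ℓ u t
  start≤step ℓ u t =
    ≤-trans (x≤max (d u) (d t)) (≤-trans (x≤x+y (0≤k·x H (0≤∣x∣ _))) (step-lower ℓ u t))

  -- A walk of length ≤ H+1 whose end points have d ≥ μ costs at least
  -- length·μ: a descent from d u to d t is paid for by the margin H·|d u − d t|.
  shortWalkBound : ∀ {μ} (p : Walk w u v) → μ ≤ d u → μ ≤ d v → length w ℕ.≤ suc H →
                   length w · μ ≤ cost p
  shortWalkBound nil _ _ _ = ≤-refl
  shortWalkBound {μ = μ} (step {ℓ = ℓ} {w = w} {u = u} t p) μ≤du μ≤dv (s≤s |w|≤H)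
    with total μ (d t)
  ... | inj₁ μ≤dt =
    +-mono-≤ (≤-trans μ≤du (start≤step ℓ u t)) (shortWalkBound p μ≤dt μ≤dv (ℕₚ.m≤n⇒m≤1+n |w|≤H))
  ... | inj₂ dt≤μ = begin
      μ + length w · μ                                  ≤⟨ +-mono-≤ μ≤du (·-monoʳ-≤ (length w) μ≤du) ⟩
      d u + length w · d u                              ≡⟨ cong (d u +_) (sym (·-sub-cancel (length w) (d u) (d t))) ⟩
      d u + (length w · (d u - d t) + length w · d t)   ≡⟨ sym (+-assoc (d u) _ _) ⟩
      (d u + length w · (d u - d t)) + length w · d t   ≤⟨ +-mono-≤ descent rest ⟩
      M ℓ u t + cost p                                  ∎
    where
    open ≤-Reasoning
    descent : d u + length w · (d u - d t) ≤ M ℓ u t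
    descent = ≤-trans (+-mono-≤ (x≤max (d u) (d t))
                                (≤-trans (·-monoˡ-≤ (0≤x-y (≤-trans dt≤μ μ≤du)) |w|≤H)
                                         (·-monoʳ-≤ H (x≤∣x∣ (d u - d t)))))
                      (step-lower ℓ u t)
    rest : length w · d t ≤ cost p
    rest = shortWalkBound p ≤-refl (≤-trans dt≤μ μ≤dv) (ℕₚ.m≤n⇒m≤1+n |w|≤H)

  record Improvement (p : Walk w u v) : Set where
    field
      walk        : Walk w u v
      fewer-moves : moves walk ℕ.< moves p
      cheaper     : cost walk ≤ cost p

  extend : ∀ {ℓ w u t v} {p : Walk w t v} → Improvement p → Improvement (step {ℓ = ℓ} {u = u} t p)
  extend {ℓ = ℓ} {u = u} {t = t} better = record
    { walk        = step t walk
    ; fewer-moves = ℕₚ.+-monoʳ-< (isMove (u ≟ t)) fewer-moves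
    ; cheaper     = +-monoʳ-≤ (M ℓ u t) cheaper }
    where open Improvement better

  cutLoop : ∀ {ℓ w u t v} (p : Walk w t v) → u ≢ t → u ∈ᵂ p → length (ℓ ∷ w) ℕ.≤ H →
            Improvement (step {ℓ = ℓ} {u = u} t p)
  cutLoop {ℓ = ℓ} {w = w} {u = u} {t = t} p u≢t u∈p short =
    record { walk = loopless ; fewer-moves = fewer ; cheaper = cheaper }
    where
    open Split (splitAt p u∈p)
    loopless : Walk (ℓ ∷ w) u _
    loopless = join (cong (ℓ ∷_) words) (stays (ℓ ∷ leftWord) u) right

    fewer : moves loopless ℕ.< moves (step {ℓ = ℓ} t p)
    fewer = begin-strict
      moves loopless                                ≡⟨ moves-join (cong (ℓ ∷_) words) (stays (ℓ ∷ leftWord) u) right ⟩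
      moves (stays (ℓ ∷ leftWord) u) ℕ.+ moves right ≡⟨ cong (ℕ._+ moves right) (moves-stays (ℓ ∷ leftWord) u) ⟩
      moves right                                   ≤⟨ ℕₚ.m≤n+m (moves right) (moves left) ⟩
      moves left ℕ.+ moves right                    ≡⟨ sym moves-split ⟩
      moves p                                       <⟨ ℕₚ.n<1+n (moves p) ⟩
      suc (moves p)                                 ≡⟨ sym (moves-step-≢ {ℓ = ℓ} p u≢t) ⟩
      moves (step {ℓ = ℓ} t p)                      ∎
      where open ℕₚ.≤-Reasoning

    loop-short : length (ℓ ∷ leftWord) ℕ.≤ suc H
    loop-short = s≤s (ℕₚ.≤-trans (ℕₚ.≤-trans (ℕₚ.m≤m+n (length leftWord) (length rightWord))
                                             (ℕₚ.≤-reflexive (trans (sym (length-++ leftWord)) (cong length words))))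
                                 (ℕₚ.≤-trans (ℕₚ.n≤1+n (length w)) short))

    cheaper : cost loopless ≤ cost (step {ℓ = ℓ} t p)
    cheaper = begin
      cost loopless                                   ≡⟨ cost-join (cong (ℓ ∷_) words) (stays (ℓ ∷ leftWord) u) right ⟩
      cost (stays (ℓ ∷ leftWord) u) + cost right      ≡⟨ cong (_+ cost right) (cost-stays (ℓ ∷ leftWord) u) ⟩
      length (ℓ ∷ leftWord) · d u + cost right        ≤⟨ +-monoˡ-≤ (cost right) (shortWalkBound (step t left) ≤-refl ≤-refl loop-short) ⟩
      (M ℓ u t + cost left) + cost right              ≡⟨ +-assoc (M ℓ u t) (cost left) (cost right) ⟩
      M ℓ u t + (cost left + cost right)              ≡⟨ cong (M ℓ u t +_) (sym cost-split) ⟩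
      M ℓ u t + cost p                                ∎
      where open ≤-Reasoning

  visited : (p : Walk w u v) → Vec Vertex (suc (moves p))
  visited (nil {v = v}) = v ∷ []
  visited (step {u = u} t p) with u ≟ t
  ... | yes _ = visited p
  ... | no _  = u ∷ visited p

  visited-avoids : ∀ {y} (p : Walk w u v) → ¬ (y ∈ᵂ p) → All (y ≢_) (visited p)
  visited-avoids nil y∉p = (λ { refl → y∉p here }) ∷ []
  visited-avoids (step {u = u} t p) y∉p with u ≟ t
  ... | yes _ = visited-avoids p (y∉p ∘ there)
  ... | no _  = (λ { refl → y∉p here }) ∷ visited-avoids p (y∉p ∘ there)

  distinct⇒few-moves : (p : Walk w u v) → Unique (visited p) → moves p ℕ.< n
  distinct⇒few-moves p distinct = injective⇒≤ (λ {i} {j} → lookup-injective distinct i j)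

  loopOrDistinct : (p : Walk w u v) → length w ℕ.≤ H → Improvement p ⊎ Unique (visited p)
  loopOrDistinct nil _ = inj₂ ([] ∷ [])
  loopOrDistinct (step {u = u} t p) short
    with u ≟ t | u ∈ᵂ? p | loopOrDistinct p (ℕₚ.≤-trans (ℕₚ.n≤1+n _) short)
  ... | no u≢t   | yes u∈p | _             = inj₁ (cutLoop p u≢t u∈p short)
  ... | _        | _       | inj₁ better   = inj₁ (extend better)
  ... | yes refl | _       | inj₂ distinct = inj₂ distinct
  ... | no _     | no u∉p  | inj₂ distinct = inj₂ (visited-avoids p u∉p ∷ distinct)

module Rerouting (R : OrderedAbelianGroup) {n : ℕ} (A B : Matrix R n)
                 (sameDiagonal : ∀ i → A i i ≡ B i i) (G : List Letter)
                 (universal : (w : Vec Letter n) → Subword (toList w) G) where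
  open OrderedGroupFacts R
  open Walks R A B sameDiagonal

  private variable
    w : List Letter
    u v : Vertex

  record StationaryBlock (p : Walk w u v) : Set where
    field
      c                       : Vertex
      beforeWord afterWord    : List Letter
      words                   : beforeWord ++ (G ++ afterWord) ≡ w
      before                  : Walk beforeWord u c
      after                   : Walk afterWord c v
      cost-split              : cost p ≡ cost before + (length G · d c + cost after)
      moves-split             : moves p ≡ moves before ℕ.+ moves after

  stationaryBlock : ∀ k (p : Walk (concat (replicate k G)) u v) → moves p ℕ.< k → StationaryBlock p
  stationaryBlock zero    p ()
  stationaryBlock (suc k) p few with splitWord G p
  ... | c₀ , p₁ , p₂ , refl with moves p₁ ℕ.≟ 0
  ...   | yes still with stationary p₁ still
  ...     | refl , cost-p₁ = record
    { c = c₀ ; beforeWord = [] ; afterWord = _ ; words = refl ; before = nil ; after = p₂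
    ; cost-split  = trans (cost-++ p₁ p₂) (trans (cong (_+ cost p₂) cost-p₁) (sym (+-identityˡ _)))
    ; moves-split = trans (moves-++ p₁ p₂) (cong (ℕ._+ moves p₂) still) }
  stationaryBlock (suc k) .(p₁ ++ᵂ p₂) few | c₀ , p₁ , p₂ , refl | no moving = record
    { c = c ; beforeWord = G ++ beforeWord ; afterWord = afterWord
    ; words  = trans (++-assoc G beforeWord (G ++ afterWord)) (cong (G ++_) words)
    ; before = p₁ ++ᵂ before ; after = after
    ; cost-split = trans (cost-++ p₁ p₂)
        (trans (cong (cost p₁ +_) cost-split)
        (trans (sym (+-assoc (cost p₁) (cost before) _)) (cong (_+ (length G · d c + cost after)) (sym (cost-++ p₁ before)))))
    ; moves-split = trans (moves-++ p₁ p₂)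
        (trans (cong (moves p₁ ℕ.+_) moves-split)
        (trans (sym (ℕₚ.+-assoc (moves p₁) (moves before) _)) (cong (ℕ._+ moves after) (sym (moves-++ p₁ before))))) }
    where
    later-few : moves p₂ ℕ.< k
    later-few = ℕₚ.≤-trans (ℕₚ.+-monoˡ-≤ (moves p₂) (ℕₚ.n≢0⇒n>0 moving))
                           (ℕₚ.≤-pred (subst (ℕ._< suc k) (moves-++ p₁ p₂) few))
    open StationaryBlock (stationaryBlock k p₂ later-few)

  -- every word of length ≤ n occurs in G: pad it to length n
  pad : ∀ {k} (r : List Letter) → length r ℕ.≤ k →
        Σ (Vec Letter k) λ padded → Σ (List Letter) λ extra → toList padded ≡ r ++ extra
  pad {k} []      _         = Vec.replicate k 𝐀 , toList (Vec.replicate k 𝐀) , refl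
  pad     (ℓ ∷ r) (s≤s r≤k) with pad r r≤k
  ... | padded , extra , e = ℓ ∷ padded , extra , cong (ℓ ∷_) e

  occurs : ∀ r → length r ℕ.≤ n → Σ (List Letter) λ pre → Σ (List Letter) λ post → pre ++ (r ++ post) ≡ G
  occurs r r≤n with pad r r≤n
  ... | padded , extra , e with universal padded
  ...   | pre , post , G≡ = pre , extra ++ post ,
          sym (trans G≡ (cong (pre ++_) (trans (cong (_++ post) e) (++-assoc r extra post))))

  -- A segment S with ≤ n moves, all of whose vertices have d ≥ μ, is
  -- replaced by a walk T over G: its route, embedded in G and padded with
  -- stays at the end points.  Paying |s|·μ for the stays S dropped,
  --   cost T + |s|·μ ≤ cost S + |G|·D   whenever d u, d v ≤ D.
  reroute : ∀ {s μ D} (S : Walk s u v) → moves S ℕ.≤ n → AllV (λ y → μ ≤ d y) S →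
            d u ≤ D → d v ≤ D → Σ (Walk G u v) λ T → cost T + length s · μ ≤ cost S + length G · D
  reroute {u = u} {v = v} {s = s} {μ = μ} {D = D} S few low du≤D dv≤D = T , bound
    where
    open Compression (compress S low)
    embedding = occurs route (subst (ℕ._≤ n) (sym route-length) few)
    pre  = proj₁ embedding
    post = proj₁ (proj₂ embedding)
    fits = proj₂ (proj₂ embedding)

    T : Walk G u v
    T = join fits (stays pre u) (path ++ᵂ stays post v)

    μ≤D : μ ≤ D
    μ≤D = ≤-trans (AllV-head S low) du≤D

    open +-Solver using (solve; _⊜_) renaming (_⊕_ to _⊞_)
    rearrange : ∀ a b c e f → (a + (b + c)) + (e + f) ≡ (b + e) + (a + (f + c))
    rearrange = solve 5 (λ a b c e f → (a ⊞ (b ⊞ c)) ⊞ (e ⊞ f) ⊜ (b ⊞ e) ⊞ (a ⊞ (f ⊞ c))) refl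

    bound : cost T + length s · μ ≤ cost S + length G · D
    bound = begin
      cost T + length s · μ
        ≡⟨ cong₂ _+_ (trans (cost-join fits (stays pre u) (path ++ᵂ stays post v))
                            (cong₂ _+_ (cost-stays pre u)
                                       (trans (cost-++ path (stays post v)) (cong (cost path +_) (cost-stays post v)))))
                     (trans (cong (_· μ) (sym length-split)) (·-distribʳ-+ dropped (length route) μ)) ⟩
      (length pre · d u + (cost path + length post · d v)) + (dropped · μ + length route · μ)
        ≡⟨ rearrange _ _ _ _ _ ⟩
      (cost path + dropped · μ) + (length pre · d u + (length route · μ + length post · d v))
        ≤⟨ +-mono-≤ cost-bound (+-mono-≤ (·-monoʳ-≤ (length pre) du≤D)
                                         (+-mono-≤ (·-monoʳ-≤ (length route) μ≤D) (·-monoʳ-≤ (length post) dv≤D))) ⟩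
      cost S + (length pre · D + (length route · D + length post · D))
        ≡⟨ cong (cost S +_) (sym (trans (cong (_· D) (cong length (sym fits)))
                                       (trans (length-·-distrib pre (route ++ post) D)
                                              (cong (length pre · D +_) (length-·-distrib route post D))))) ⟩
      cost S + length G · D ∎
      where open ≤-Reasoning

  valley : ∀ {s c₁ c₂} (S : Walk s c₁ c₂) → moves S ℕ.≤ n →
    Σ Vertex λ m → Σ (Walk G c₁ m) λ T₁ → Σ (Walk G m c₂) λ T₂ →
      cost T₁ + (cost (stays s m) + cost T₂) ≤ length G · d c₁ + (cost S + length G · d c₂)
  valley {s = s} {c₁} {c₂} S few with lowestVertex S
  ... | m , m∈S , low = m , T₁ , T₂ , bound
    where
    open Split (splitAt S m∈S)
    few-left : moves left ℕ.≤ n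
    few-left = ℕₚ.≤-trans (ℕₚ.m≤m+n (moves left) (moves right)) (subst (ℕ._≤ n) moves-split few)
    few-right : moves right ℕ.≤ n
    few-right = ℕₚ.≤-trans (ℕₚ.m≤n+m (moves right) (moves left)) (subst (ℕ._≤ n) moves-split few)

    down = reroute left  few-left  (proj₁ (all-split low)) ≤-refl (AllV-head S low)
    up   = reroute right few-right (proj₂ (all-split low)) (AllV-last S low) ≤-refl
    T₁ = proj₁ down
    T₂ = proj₁ up

    open +-Solver using (solve; _⊜_) renaming (_⊕_ to _⊞_)
    bound : cost T₁ + (cost (stays s m) + cost T₂) ≤ length G · d c₁ + (cost S + length G · d c₂)
    bound = begin
      cost T₁ + (cost (stays s m) + cost T₂)
        ≡⟨ cong (λ z → cost T₁ + (z + cost T₂))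
                (trans (cost-stays s m) (trans (cong (λ w → length w · d m) (sym words))
                                               (length-·-distrib leftWord rightWord (d m)))) ⟩
      cost T₁ + ((length leftWord · d m + length rightWord · d m) + cost T₂)
        ≡⟨ solve 4 (λ a b c e → a ⊞ ((b ⊞ c) ⊞ e) ⊜ (a ⊞ b) ⊞ (e ⊞ c)) refl _ _ _ _ ⟩
      (cost T₁ + length leftWord · d m) + (cost T₂ + length rightWord · d m)
        ≤⟨ +-mono-≤ (proj₂ down) (proj₂ up) ⟩
      (cost left + length G · d c₁) + (cost right + length G · d c₂)
        ≡⟨ solve 4 (λ a b c e → (a ⊞ b) ⊞ (c ⊞ e) ⊜ b ⊞ ((a ⊞ c) ⊞ e)) refl _ _ _ _ ⟩
      length G · d c₁ + ((cost left + cost right) + length G · d c₂)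
        ≡⟨ cong (λ z → length G · d c₁ + (z + length G · d c₂)) (sym cost-split) ⟩
      length G · d c₁ + (cost S + length G · d c₂) ∎
      where open ≤-Reasoning

module MiddleStayTheorem (R : OrderedAbelianGroup) {n : ℕ} (A B : Matrix R n)
                         (sameDiagonal : ∀ i → A i i ≡ B i i) (H : ℕ)
                         (dominant : DiagDominant R H (_⊕_ R A B)) (G : List Letter)
                         (universal : (w : Vec Letter n) → Subword (toList w) G) (x : Letter)
                         (short : length (sandwich n G x) ℕ.≤ H) where
  open OrderedGroupFacts R
  open Walks R A B sameDiagonal
  open Dominance R A B sameDiagonal H dominant
  open Rerouting R A B sameDiagonal G universal

  private variable
    u v : Vertex

  Gⁿ : List Letter
  Gⁿ = concat (replicate n G)

  length-Gⁿ : length Gⁿ ≡ n ℕ.* length G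
  length-Gⁿ = length-copies G n

  record MiddleStay (p : Walk (sandwich n G x) u v) : Set where
    field
      c       : Vertex
      before  : Walk Gⁿ u c
      after   : Walk Gⁿ c v
      cheaper : cost (before ++ᵂ step {ℓ = x} c after) ≤ cost p

  MiddleStay-≤ : ∀ {p q : Walk (sandwich n G x) u v} → MiddleStay q → cost q ≤ cost p → MiddleStay p
  MiddleStay-≤ ms q≤p = record { c = c ; before = before ; after = after ; cheaper = ≤-trans cheaper q≤p }
    where open MiddleStay ms

  middleStay : (p : Walk (sandwich n G x) u v) → moves p ℕ.< n → MiddleStay p
  middleStay p few with splitWord Gⁿ p
  ... | a , L , step b R , refl = record { c = m ; before = before′ ; after = after′ ; cheaper = cheaper }
    where
    moves-p : moves (L ++ᵂ step {ℓ = x} b R) ≡ moves L ℕ.+ (isMove (a ≟ b) ℕ.+ moves R)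
    moves-p = moves-++ L (step b R)
    few-L : moves L ℕ.< n
    few-L = ℕₚ.≤-<-trans (ℕₚ.m≤m+n (moves L) _) (subst (ℕ._< n) moves-p few)
    few-R : moves R ℕ.< n
    few-R = ℕₚ.≤-<-trans (ℕₚ.≤-trans (ℕₚ.m≤n+m (moves R) (isMove (a ≟ b))) (ℕₚ.m≤n+m _ (moves L)))
                         (subst (ℕ._< n) moves-p few)
    module BL = StationaryBlock (stationaryBlock n L few-L)
    module BR = StationaryBlock (stationaryBlock n R few-R)

    S : Walk (BL.afterWord ++ x ∷ BR.beforeWord) BL.c BR.c
    S = BL.after ++ᵂ step b BR.before
    few-S : moves S ℕ.≤ n
    few-S = ℕₚ.<⇒≤ (ℕₚ.≤-<-trans
      (ℕₚ.≤-reflexive (moves-++ BL.after (step b BR.before)))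
      (ℕₚ.≤-<-trans (ℕₚ.+-mono-≤ (ℕₚ.≤-trans (ℕₚ.m≤n+m _ (moves BL.before)) (ℕₚ.≤-reflexive (sym BL.moves-split)))
                                 (ℕₚ.+-monoʳ-≤ (isMove (a ≟ b))
                                   (ℕₚ.≤-trans (ℕₚ.m≤m+n _ (moves BR.after)) (ℕₚ.≤-reflexive (sym BR.moves-split)))))
                    (subst (ℕ._< n) moves-p few)))

    flattened = valley S few-S
    m  = proj₁ flattened
    T₁ = proj₁ (proj₂ flattened)
    T₂ = proj₁ (proj₂ (proj₂ flattened))

    before′ : Walk Gⁿ _ m
    before′ = join BL.words BL.before (T₁ ++ᵂ stays BL.afterWord m)
    after′ : Walk Gⁿ m _
    after′ = join BR.words (stays BR.beforeWord m) (T₂ ++ᵂ BR.after)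

    open +-Solver using (solve; _⊜_) renaming (_⊕_ to _⊞_)
    cheaper : cost (before′ ++ᵂ step m after′) ≤ cost (L ++ᵂ step b R)
    cheaper = begin
      cost (before′ ++ᵂ step m after′)
        ≡⟨ cost-++ before′ (step m after′) ⟩
      cost before′ + (M x m m + cost after′)
        ≡⟨ cong₂ (λ y z → y + (M x m m + z))
                 (trans (cost-join BL.words BL.before (T₁ ++ᵂ stays BL.afterWord m))
                        (cong (cost BL.before +_) (cost-++ T₁ (stays BL.afterWord m))))
                 (trans (cost-join BR.words (stays BR.beforeWord m) (T₂ ++ᵂ BR.after))
                        (cong (cost (stays BR.beforeWord m) +_) (cost-++ T₂ BR.after))) ⟩
      (cost BL.before + (cost T₁ + cost (stays BL.afterWord m)))
        + (M x m m + (cost (stays BR.beforeWord m) + (cost T₂ + cost BR.after)))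
        ≡⟨ solve 7 (λ p q r s t u v → (p ⊞ (q ⊞ r)) ⊞ (s ⊞ (t ⊞ (u ⊞ v)))
                                   ⊜ p ⊞ ((q ⊞ ((r ⊞ (s ⊞ t)) ⊞ u)) ⊞ v)) refl _ _ _ _ _ _ _ ⟩
      cost BL.before + ((cost T₁ + ((cost (stays BL.afterWord m) + (M x m m + cost (stays BR.beforeWord m)))
                                    + cost T₂)) + cost BR.after)
        ≡⟨ cong (λ z → cost BL.before + ((cost T₁ + (z + cost T₂)) + cost BR.after))
                (sym (cost-stays-++ BL.afterWord (x ∷ BR.beforeWord) m)) ⟩
      cost BL.before + ((cost T₁ + (cost (stays (BL.afterWord ++ x ∷ BR.beforeWord) m) + cost T₂)) + cost BR.after)
        ≤⟨ +-monoʳ-≤ (cost BL.before) (+-monoˡ-≤ (cost BR.after) (proj₂ (proj₂ (proj₂ flattened)))) ⟩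
      cost BL.before + ((length G · d BL.c + (cost S + length G · d BR.c)) + cost BR.after)
        ≡⟨ cong (λ z → cost BL.before + ((length G · d BL.c + (z + length G · d BR.c)) + cost BR.after))
                (cost-++ BL.after (step b BR.before)) ⟩
      cost BL.before + ((length G · d BL.c + ((cost BL.after + (M x a b + cost BR.before))
                                              + length G · d BR.c)) + cost BR.after)
        ≡⟨ solve 7 (λ p g₁ e f h g₂ v → p ⊞ ((g₁ ⊞ ((e ⊞ (f ⊞ h)) ⊞ g₂)) ⊞ v)
                                     ⊜ (p ⊞ (g₁ ⊞ e)) ⊞ (f ⊞ (h ⊞ (g₂ ⊞ v)))) refl _ _ _ _ _ _ _ ⟩
      (cost BL.before + (length G · d BL.c + cost BL.after))
        + (M x a b + (cost BR.before + (length G · d BR.c + cost BR.after)))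
        ≡⟨ cong₂ (λ y z → y + (M x a b + z)) (sym BL.cost-split) (sym BR.cost-split) ⟩
      cost L + (M x a b + cost R)
        ≡⟨ sym (cost-++ L (step b R)) ⟩
      cost (L ++ᵂ step b R) ∎
      where open ≤-Reasoning

  -- Cut loops until the moves start at distinct vertices (then there are
  -- fewer than n); the number of moves bounds the number of rounds.
  toMiddleStay : ∀ rounds (p : Walk (sandwich n G x) u v) → moves p ℕ.< rounds → MiddleStay p
  toMiddleStay zero         p ()
  toMiddleStay (suc rounds) p bounded with loopOrDistinct p short
  ... | inj₁ better   = MiddleStay-≤ (toMiddleStay rounds walk (ℕₚ.<-≤-trans fewer-moves (ℕₚ.≤-pred bounded))) cheaper
    where open Improvement better
  ... | inj₂ distinct = middleStay p (distinct⇒few-moves p distinct)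

  theorem : (κ₀ κₕ : Vertex) →
    Σ (Fin (suc (length (sandwich n G x))) → Vertex) λ κ →
      (κ zero ≡ κ₀) × (κ (fromℕ (length (sandwich n G x))) ≡ κₕ) ×
      ((i j : Fin (suc (length (sandwich n G x)))) →
         toℕ i ≡ n ℕ.* length G → toℕ j ≡ suc (n ℕ.* length G) → κ i ≡ κ j) ×
      ((κ′ : Fin (suc (length (sandwich n G x))) → Vertex) →
         κ′ zero ≡ κ₀ → κ′ (fromℕ (length (sandwich n G x))) ≡ κₕ →
         β R A B (sandwich n G x) κ ≤ β R A B (sandwich n G x) κ′)
  theorem κ₀ κₕ = positions Q , refl , positions-last Q , stay , optimal
    where
    cheapest = cheapestWalk (stays Gⁿ κ₀ ++ᵂ step κₕ (stays Gⁿ κₕ))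
    P* = proj₁ cheapest
    open MiddleStay (toMiddleStay (suc (moves P*)) P* (ℕₚ.n<1+n (moves P*)))

    Q : Walk (sandwich n G x) κ₀ κₕ
    Q = before ++ᵂ step c after

    stay : (i j : Fin (suc (length (sandwich n G x)))) →
           toℕ i ≡ n ℕ.* length G → toℕ j ≡ suc (n ℕ.* length G) → positions Q i ≡ positions Q j
    stay i j i≡ j≡ = trans (positions-stay before after i (inj₁ (trans i≡ (sym length-Gⁿ))))
                     (sym (positions-stay before after j (inj₂ (trans j≡ (cong suc (sym length-Gⁿ))))))

    cheapest-at : ∀ {u′ v′} (q : Walk (sandwich n G x) u′ v′) → u′ ≡ κ₀ → v′ ≡ κₕ → cost P* ≤ cost q
    cheapest-at q refl refl = proj₂ cheapest q

    optimal : (κ′ : Fin (suc (length (sandwich n G x))) → Vertex) →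
              κ′ zero ≡ κ₀ → κ′ (fromℕ (length (sandwich n G x))) ≡ κₕ →
              β R A B (sandwich n G x) (positions Q) ≤ β R A B (sandwich n G x) κ′
    optimal κ′ κ′₀ κ′ₕ = begin
      β R A B (sandwich n G x) (positions Q) ≡⟨ β-positions Q ⟩
      cost Q                                  ≤⟨ cheaper ⟩
      cost P*                                 ≤⟨ cheapest-at (walkOf (sandwich n G x) κ′) κ′₀ κ′ₕ ⟩
      cost (walkOf (sandwich n G x) κ′)       ≡⟨ cost-walkOf (sandwich n G x) κ′ ⟩
      β R A B (sandwich n G x) κ′             ∎
      where open ≤-Reasoning

length-sandwich : ∀ n G x → length (sandwich n G x) ≡ 2 ℕ.* n ℕ.* length G ℕ.+ 1
length-sandwich n G x = begin
  length (concat (replicate n G) ++ x ∷ concat (replicate n G))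
    ≡⟨ length-++ (concat (replicate n G)) ⟩
  length (concat (replicate n G)) ℕ.+ suc (length (concat (replicate n G)))
    ≡⟨ cong (λ k → k ℕ.+ suc k) (length-copies G n) ⟩
  n ℕ.* length G ℕ.+ suc (n ℕ.* length G)
    ≡⟨ arithmetic n (length G) ⟩
  2 ℕ.* n ℕ.* length G ℕ.+ 1 ∎
  where
  open Relation.Binary.PropositionalEquality.≡-Reasoning
  arithmetic : ∀ k g → k ℕ.* g ℕ.+ suc (k ℕ.* g) ≡ 2 ℕ.* k ℕ.* g ℕ.+ 1
  arithmetic = solve-∀

mainTheorem11 : (R : OrderedAbelianGroup) → (n : ℕ) → (A B : Matrix R n) →
    (G : List Letter) → (x : Letter) → (κ₀ κₕ : Fin n) →
    DominantPair R (2 ℕ.* n ℕ.* length G ℕ.+ 1) A B →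
    ((w : Vec Letter n) → Subword (toList w) G) →
    Σ (Fin (suc (length (sandwich n G x))) → Fin n) λ κ →
      (κ zero ≡ κ₀) × (κ (fromℕ (length (sandwich n G x))) ≡ κₕ) ×
      ((i j : Fin (suc (length (sandwich n G x)))) →
         toℕ i ≡ n ℕ.* length G → toℕ j ≡ suc (n ℕ.* length G) → κ i ≡ κ j) ×
      ((κ′ : Fin (suc (length (sandwich n G x))) → Fin n) →
         κ′ zero ≡ κ₀ → κ′ (fromℕ (length (sandwich n G x))) ≡ κₕ →
         OrderedAbelianGroup._≤_ R (β R A B (sandwich n G x) κ)
                                   (β R A B (sandwich n G x) κ′))
mainTheorem11 R n A B G x κ₀ κₕ (sameDiagonal , dominant) universal =
  MiddleStayTheorem.theorem R A B sameDiagonal H dominant G universal x short κ₀ κₕ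
  where
  H : ℕ
  H = 2 ℕ.* n ℕ.* length G ℕ.+ 1
  short : length (sandwich n G x) ℕ.≤ H
  short = ℕₚ.≤-reflexive (length-sandwich n G x)
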